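{- Let $G$ be a connected finite $\delta$-hyperbolic graph and $P(y,x)$ a shortest path from $y$ to $x$. If $P(y,x)$ is strict end-minimal, then $d(x,y)\le e(y)-e(x)+\max\{0,4\delta-1\}$; if $P(y,x)$ is end-minimal, then $d(x,y)\le e(y)-e(x)+4\delta+1$. Moreover, for a vertex $x'$ of $P(y,x)$, $d(y,x')\le e(y)-e(x')+2\delta$ if $e(x')>e(x)+\delta$, or if $P(y,x)$ is end-minimal and $d(x,x')>2\delta$.
   Context: $G$ is $\delta$-hyperbolic if for any four vertices $u,v,w,x$ the two larger of $d(u,v)+d(w,x)$, $d(u,w)+d(v,x)$, $d(u,x)+d(v,w)$ differ by at most $2\delta$ ($d$ = shortest-path distance). $e(v)=\max_u d(v,u)$. A shortest path $P(y,x)$ is end-minimal if $e(x)\le e(v)$ for all $v\in P(y,x)$, and strict end-minimal if $e(x)<e(v)$ for all $v\in P(y,x)$, $v\ne x$. -}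

module Defs where

open import Level using (0ℓ)
open import Data.Nat using (ℕ; zero; suc; _+_; _*_; _∸_; _≤_; _<_; _⊔_; _⊓_)
open import Data.Fin using (Fin)
open import Data.List using (List; map; foldr; allFin)
open import Data.Product using (_×_; ∃)
open import Relation.Binary.PropositionalEquality using (_≡_; _≢_)
open import Relation.Nullary using (¬_)

record Graph : Set₁ where
  field
    n     : ℕ
    Adj   : Fin n → Fin n → Set
    sym   : ∀ {u v} → Adj u v → Adj v u
    irrefl : ∀ {u} → ¬ Adj u u

module _ (G : Graph) where
  open Graph G

  V : Set
  V = Fin n

  data Walk : V → V → ℕ → Set where
    []  : ∀ {u} → Walk u u 0
    _∷_ : ∀ {u w v m} → Adj u w → Walk w v m → Walk u v (suc m)

  data _∈W_ (z : V) : ∀ {u v m} → Walk u v m → Set where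
    here-end : z ∈W ([] {z})
    here     : ∀ {w v m} (a : Adj z w) (p : Walk w v m) → z ∈W (a ∷ p)
    there    : ∀ {u w v m} (a : Adj u w) {p : Walk w v m} → z ∈W p → z ∈W (a ∷ p)

  Connected : Set
  Connected = ∀ u v → ∃ λ m → Walk u v m

  IsDistance : (V → V → ℕ) → Set
  IsDistance d = ∀ u v → (∃ λ m → m ≡ d u v × Walk u v m)
                       × (∀ m → Walk u v m → d u v ≤ m)

  module _ (d : V → V → ℕ) where

    ecc : V → ℕ
    ecc v = foldr _⊔_ 0 (map (d v) (allFin n))

    -- δ-hyperbolicity with k = 2δ: the largest of the three distance sums
    -- exceeds the middle one (the median) by at most k.
    largest3 median3 : ℕ → ℕ → ℕ → ℕ
    largest3 a b c = a ⊔ b ⊔ c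
    median3 a b c = (a ⊓ b) ⊔ (b ⊓ c) ⊔ (a ⊓ c)

    Hyperbolic2δ : ℕ → Set
    Hyperbolic2δ k = ∀ u v w x →
      let s₁ = d u v + d w x
          s₂ = d u w + d v x
          s₃ = d u x + d v w
      in largest3 s₁ s₂ s₃ ≤ median3 s₁ s₂ s₃ + k

    IsShortest : ∀ {y x m} → Walk y x m → Set
    IsShortest {y} {x} {m} _ = m ≡ d y x

    EndMinimal : ∀ {y x m} → Walk y x m → Set
    EndMinimal {y} {x} P = ∀ v → v ∈W P → ecc x ≤ ecc v

    StrictEndMinimal : ∀ {y x m} → Walk y x m → Set
    StrictEndMinimal {y} {x} P = ∀ v → v ∈W P → v ≢ x → ecc x < ecc v

-- Let x′ be a vertex of the geodesic P(y,x) and z a vertex farthest from x′. In the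
-- four-point condition for y, x, x′, z the sum d(y,x) + d(x′,z) = d(y,x′) + d(x′,x) + e(x′)
-- exceeds d(y,x′) + d(x,z) or d(y,z) + d(x,x′) by at most 2δ, so
--   d(x,x′) + e(x′) ≤ e(x) + 2δ   or   d(y,x′) + e(x′) ≤ e(y) + 2δ.
-- The first alternative is impossible when e(x′) > e(x) + δ (as e(x′) ≤ d(x,x′) + e(x)), or
-- when P is end-minimal and d(x,x′) > 2δ. Applying the second alternative to the vertex of P
-- at distance 2δ + 1 from x (resp. max{2δ,1}, where strictness gives e(x′) > e(x)) bounds d(x,y).
module Submission where

open import Defs
open import Data.Nat using (ℕ; zero; suc; _+_; _*_; _∸_; _≤_; _<_; _⊔_; _⊓_; z≤n; s≤s; s≤s⁻¹; _≤?_)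
open import Data.Nat.Properties
open import Data.Nat.Solver using (module +-*-Solver)
open import Data.Product using (_×_; _,_; proj₁; proj₂; ∃)
open import Data.Sum as Sum using (_⊎_; inj₁; inj₂)
open import Data.Fin using () renaming (_≟_ to _≟ᶠ_)
open import Data.List using ([]; _∷_; map; foldr; allFin)
open import Data.List.Relation.Unary.Any using (here; there)
open import Data.List.Membership.Propositional using (_∈_)
open import Data.List.Membership.Propositional.Properties using (∈-allFin)
open import Relation.Nullary using (yes; no; contradiction)
open import Relation.Binary.PropositionalEquality

open +-*-Solver

median3≤⊔ : ∀ a b c → (a ⊓ b) ⊔ (b ⊓ c) ⊔ (a ⊓ c) ≤ b ⊔ c
median3≤⊔ a b c = ⊔-lub (⊔-lub (≤-trans (m⊓n≤n a b) (m≤m⊔n b c)) (≤-trans (m⊓n≤m b c) (m≤m⊔n b c)))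
                        (≤-trans (m⊓n≤n a c) (m≤n⊔m b c))

≤⊔+⇒≤+⊎≤+ : ∀ {a} b c {k} → a ≤ b ⊔ c + k → a ≤ b + k ⊎ a ≤ c + k
≤⊔+⇒≤+⊎≤+ {a} b c {k} h with ⊔-sel b c
... | inj₁ b⊔c≡b = inj₁ (subst (λ t → a ≤ t + k) b⊔c≡b h)
... | inj₂ b⊔c≡c = inj₂ (subst (λ t → a ≤ t + k) b⊔c≡c h)

largest≤median+k⇒≤+k : ∀ a b c k → a ⊔ b ⊔ c ≤ (a ⊓ b) ⊔ (b ⊓ c) ⊔ (a ⊓ c) + k →
                       a ≤ b + k ⊎ a ≤ c + k
largest≤median+k⇒≤+k a b c k h = ≤⊔+⇒≤+⊎≤+ b c (begin
  a                               ≤⟨ m≤m⊔n a b ⟩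
  a ⊔ b                           ≤⟨ m≤m⊔n (a ⊔ b) c ⟩
  a ⊔ b ⊔ c                       ≤⟨ h ⟩
  (a ⊓ b) ⊔ (b ⊓ c) ⊔ (a ⊓ c) + k ≤⟨ +-monoˡ-≤ k (median3≤⊔ a b c) ⟩
  b ⊔ c + k                       ∎)
  where open ≤-Reasoning

+-≤-+-squeeze : ∀ {a b i j} → a ≤ i → b ≤ j → i + j ≤ a + b → a ≡ i × b ≡ j
+-≤-+-squeeze {a} {b} {i} {j} a≤i b≤j h =
  ≤-antisym a≤i (+-cancelʳ-≤ j i a (≤-trans h (+-monoʳ-≤ a b≤j))) ,
  ≤-antisym b≤j (+-cancelˡ-≤ i j b (≤-trans h (+-monoˡ-≤ b a≤i)))

+-≤-+⇒≤ : ∀ {a b c k} → a + b ≤ c + k → c ≤ b → a ≤ k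
+-≤-+⇒≤ {a} {b} {c} {k} h c≤b =
  +-cancelˡ-≤ c a k (subst (_≤ c + k) (+-comm a c) (≤-trans (+-monoʳ-≤ a c≤b) h))

+-≤-+⇒< : ∀ {a b c k} → a + b ≤ c + k → c < b → a < k
+-≤-+⇒< h c<b = +-≤-+⇒≤ (s≤s h) c<b

[a+b]+c≤[a+d]+k⇒b+c≤d+k : ∀ a b c d k → a + b + c ≤ a + d + k → b + c ≤ d + k
[a+b]+c≤[a+d]+k⇒b+c≤d+k a b c d k h =
  +-cancelˡ-≤ a _ _ (subst₂ _≤_ (+-assoc a b c) (+-assoc a d k) h)

[a+b]+c≤[d+b]+k⇒a+c≤d+k : ∀ a b c d k → a + b + c ≤ d + b + k → a + c ≤ d + k
[a+b]+c≤[d+b]+k⇒a+c≤d+k a b c d k h = +-cancelʳ-≤ b _ _ (subst₂ _≤_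
  (solve 3 (λ a b c → a :+ b :+ c := a :+ c :+ b) refl a b c)
  (solve 3 (λ d b k → d :+ b :+ k := d :+ k :+ b) refl d b k) h)

a+b≤c+k⇒b≤a+c⇒2b≤2c+k : ∀ {a b c k} → a + b ≤ c + k → b ≤ a + c → 2 * b ≤ 2 * c + k
a+b≤c+k⇒b≤a+c⇒2b≤2c+k {a} {b} {c} {k} h₁ h₂ = +-cancelˡ-≤ a _ _ (subst₂ _≤_
  (solve 2 (λ a b → a :+ b :+ b := a :+ con 2 :* b) refl a b)
  (solve 3 (λ a c k → c :+ k :+ (a :+ c) := a :+ (con 2 :* c :+ k)) refl a c k)
  (+-mono-≤ h₁ h₂))

a+[1+b]≤c+[k+[1+j]]⇒a+b≤c+[k+j] : ∀ a b c k j → a + suc b ≤ c + (k + suc j) → a + b ≤ c + (k + j)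
a+[1+b]≤c+[k+[1+j]]⇒a+b≤c+[k+j] a b c k j h = s≤s⁻¹ (subst₂ _≤_
  (+-suc a b) (trans (cong (c +_) (+-suc k j)) (+-suc c (k + j))) h)

2*k+1≡k+[1+k] : ∀ k → 2 * k + 1 ≡ k + suc k
2*k+1≡k+[1+k] = solve 1 (λ k → con 2 :* k :+ con 1 := k :+ (con 1 :+ k)) refl

2*k∸1≡k+[k∸1] : ∀ k → 2 * k ∸ 1 ≡ k + (k ∸ 1)
2*k∸1≡k+[k∸1] zero    = refl
2*k∸1≡k+[k∸1] (suc k) = trans (+-suc k (k + 0)) (cong (λ t → suc (k + t)) (+-identityʳ k))

module Walks (G : Graph) where
  open Graph G using (Adj)

  _++_ : ∀ {u v w i j} → Walk G u v i → Walk G v w j → Walk G u w (i + j)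
  []      ++ q = q
  (a ∷ p) ++ q = a ∷ (p ++ q)

  _∷ʳ_ : ∀ {u v w i} → Walk G u v i → Adj v w → Walk G u w (suc i)
  []      ∷ʳ a = a ∷ []
  (b ∷ p) ∷ʳ a = b ∷ (p ∷ʳ a)

  reverse : ∀ {u v i} → Walk G u v i → Walk G v u i
  reverse []      = []
  reverse (a ∷ p) = reverse p ∷ʳ Graph.sym G a

  start-∈W : ∀ {y x m} (P : Walk G y x m) → _∈W_ G y P
  start-∈W []      = here-end
  start-∈W (a ∷ p) = here a p

  SplitAt : V G → V G → ℕ → V G → ℕ → Set
  SplitAt y x m x′ j = ∃ λ i → Walk G y x′ i × Walk G x′ x j × i + j ≡ m

  ∈W⇒split : ∀ {y x m x′} (P : Walk G y x m) → _∈W_ G x′ P → ∃ (SplitAt y x m x′)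
  ∈W⇒split .[]      here-end       = 0 , 0 , [] , [] , refl
  ∈W⇒split .(a ∷ p) (here a p)     = _ , 0 , [] , a ∷ p , refl
  ∈W⇒split (a ∷ _)  (there .a x′∈p) with ∈W⇒split _ x′∈p
  ... | j , i , p₁ , p₂ , i+j≡m = j , suc i , a ∷ p₁ , p₂ , cong suc i+j≡m

  split-at-suffix-length : ∀ {y x m} (P : Walk G y x m) {j} → j ≤ m →
                           ∃ λ x′ → _∈W_ G x′ P × SplitAt y x m x′ j
  split-at-suffix-length {y} [] z≤n = y , here-end , 0 , [] , [] , refl
  split-at-suffix-length {y} (a ∷ p) j≤1+m with m≤n⇒m<n∨m≡n j≤1+m
  ... | inj₂ refl = y , here a p , 0 , [] , a ∷ p , refl
  ... | inj₁ j<1+m with split-at-suffix-length p (s≤s⁻¹ j<1+m)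
  ...   | x′ , x′∈p , i , p₁ , p₂ , i+j≡m = x′ , there a x′∈p , suc i , a ∷ p₁ , p₂ , cong suc i+j≡m

module _ {A : Set} (f : A → ℕ) where

  ≤foldr-⊔ : ∀ {u} xs → u ∈ xs → f u ≤ foldr _⊔_ 0 (map f xs)
  ≤foldr-⊔ (x ∷ xs) (here refl) = m≤m⊔n (f x) _
  ≤foldr-⊔ (x ∷ xs) (there u∈xs) = ≤-trans (≤foldr-⊔ xs u∈xs) (m≤n⊔m (f x) _)

  foldr-⊔-attained : ∀ xs → (∃ λ u → f u ≡ foldr _⊔_ 0 (map f xs)) ⊎ foldr _⊔_ 0 (map f xs) ≡ 0
  foldr-⊔-attained [] = inj₂ refl
  foldr-⊔-attained (x ∷ xs) with ⊔-sel (f x) (foldr _⊔_ 0 (map f xs))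
  ... | inj₁ ≡fx = inj₁ (x , sym ≡fx)
  ... | inj₂ ≡rest with foldr-⊔-attained xs
  ...   | inj₁ (u , fu≡) = inj₁ (u , trans fu≡ (sym ≡rest))
  ...   | inj₂ ≡0        = inj₂ (trans ≡rest ≡0)

module Distance (G : Graph) (d : V G → V G → ℕ) (isD : IsDistance G d) where
  open Walks G

  d≤length : ∀ {u v m} → Walk G u v m → d u v ≤ m
  d≤length {u} {v} {m} = proj₂ (isD u v) m

  geodesic : ∀ u v → Walk G u v (d u v)
  geodesic u v with proj₁ (isD u v)
  ... | m , m≡d , p = subst (Walk G u v) m≡d p

  d-refl : ∀ u → d u u ≡ 0
  d-refl u = n≤0⇒n≡0 (d≤length [])

  d-sym : ∀ u v → d u v ≡ d v u
  d-sym u v = ≤-antisym (d≤length (reverse (geodesic v u))) (d≤length (reverse (geodesic u v)))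

  d-triangle : ∀ u v w → d u w ≤ d u v + d v w
  d-triangle u v w = d≤length (geodesic u v ++ geodesic v w)

  shortest-split : ∀ {y x m x′ j} → m ≡ d y x → SplitAt y x m x′ j → d y x′ + j ≡ d y x × d x′ x ≡ j
  shortest-split {y} {x} {m} {x′} m≡d (i , p₁ , p₂ , i+j≡m)
    with +-≤-+-squeeze (d≤length p₁) (d≤length p₂)
           (subst (_≤ d y x′ + d x′ x) (sym (trans i+j≡m m≡d)) (d-triangle y x′ x))
  ... | refl , refl = trans i+j≡m m≡d , refl

  d≡1+n⇒≢ : ∀ {u v j} → d u v ≡ suc j → v ≢ u
  d≡1+n⇒≢ {u} duv≡1+j refl = 0≢1+n (trans (sym (d-refl u)) duv≡1+j)

  e : V G → ℕ
  e = ecc G d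

  d≤ecc : ∀ v u → d v u ≤ e v
  d≤ecc v u = ≤foldr-⊔ (d v) (allFin _) (∈-allFin u)

  ecc-attained : ∀ v → ∃ λ z → d v z ≡ e v
  ecc-attained v with foldr-⊔-attained (d v) (allFin _)
  ... | inj₁ attained = attained
  ... | inj₂ e≡0      = v , trans (d-refl v) (sym e≡0)

  ecc≤d+ecc : ∀ v w → e v ≤ d v w + e w
  ecc≤d+ecc v w with ecc-attained v
  ... | z , dvz≡e = subst (_≤ d v w + e w) dvz≡e
                      (≤-trans (d-triangle v w z) (+-monoʳ-≤ (d v w) (d≤ecc w z)))

module ShortestPath (G : Graph) (d : V G → V G → ℕ) (isD : IsDistance G d)
                    (k : ℕ) (hyp : Hyperbolic2δ G d k)
                    {y x m} (P : Walk G y x m) (short : IsShortest G d P) where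
  open Walks G
  open Distance G d isD

  _∈P : V G → Set
  x′ ∈P = _∈W_ G x′ P

  d-through : ∀ {x′} → x′ ∈P → d y x′ + d x x′ ≡ d y x
  d-through {x′} x′∈P with ∈W⇒split P x′∈P
  ... | j , split with shortest-split short split
  ...   | dyx′+j≡ , dx′x≡j = trans (cong (d y x′ +_) (trans (d-sym x x′) dx′x≡j)) dyx′+j≡

  vertex-at-distance : ∀ {j} → j ≤ d x y → ∃ λ x′ → x′ ∈P × d x x′ ≡ j
  vertex-at-distance {j} j≤dxy
    with split-at-suffix-length P (≤-trans j≤dxy (≤-reflexive (trans (d-sym x y) (sym short))))
  ... | x′ , x′∈P , split = x′ , x′∈P , trans (d-sym x x′) (proj₂ (shortest-split short split))

  near-x-or-near-y : ∀ {x′} → x′ ∈P → d x x′ + e x′ ≤ e x + k ⊎ d y x′ + e x′ ≤ e y + k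
  near-x-or-near-y {x′} x′∈P with ecc-attained x′
  ... | z , dx′z≡e = Sum.map near-x near-y (largest≤median+k⇒≤+k _ _ _ k (hyp y x x′ z))
    where
    s₁≡ : d y x + d x′ z ≡ d y x′ + d x x′ + e x′
    s₁≡ = cong₂ _+_ (sym (d-through x′∈P)) dx′z≡e

    near-x : d y x + d x′ z ≤ d y x′ + d x z + k → d x x′ + e x′ ≤ e x + k
    near-x h = ≤-trans ([a+b]+c≤[a+d]+k⇒b+c≤d+k (d y x′) (d x x′) (e x′) (d x z) k
                          (subst (_≤ d y x′ + d x z + k) s₁≡ h))
                       (+-monoˡ-≤ k (d≤ecc x z))

    near-y : d y x + d x′ z ≤ d y z + d x x′ + k → d y x′ + e x′ ≤ e y + k
    near-y h = ≤-trans ([a+b]+c≤[d+b]+k⇒a+c≤d+k (d y x′) (d x x′) (e x′) (d y z) k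
                          (subst (_≤ d y z + d x x′ + k) s₁≡ h))
                       (+-monoˡ-≤ k (d≤ecc y z))

  bound-through : ∀ {x′} → x′ ∈P → d y x′ + e x′ ≤ e y + k → d x y + e x′ ≤ e y + (k + d x x′)
  bound-through {x′} x′∈P h = begin
    d x y + e x′            ≡⟨ cong (_+ e x′) (trans (d-sym x y) (sym (d-through x′∈P))) ⟩
    d y x′ + d x x′ + e x′  ≡⟨ solve 3 (λ a b c → a :+ b :+ c := a :+ c :+ b) refl (d y x′) (d x x′) (e x′) ⟩
    d y x′ + e x′ + d x x′  ≤⟨ +-monoˡ-≤ (d x x′) h ⟩
    e y + k + d x x′        ≡⟨ +-assoc (e y) k (d x x′) ⟩
    e y + (k + d x x′)      ∎
    where open ≤-Reasoning

  far-vertex-near-y : ∀ {x′} → x′ ∈P →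
                      2 * e x + k < 2 * e x′ ⊎ (EndMinimal G d P × k < d x x′) →
                      d y x′ + e x′ ≤ e y + k
  far-vertex-near-y {x′} x′∈P far with near-x-or-near-y x′∈P
  ... | inj₂ near-y = near-y
  ... | inj₁ near-x with far
  ...   | inj₁ e-far = contradiction (a+b≤c+k⇒b≤a+c⇒2b≤2c+k near-x ex′≤dxx′+ex) (<⇒≱ e-far)
    where
    ex′≤dxx′+ex : e x′ ≤ d x x′ + e x
    ex′≤dxx′+ex = subst (λ t → e x′ ≤ t + e x) (d-sym x′ x) (ecc≤d+ecc x′ x)
  ...   | inj₂ (end-min , d-far) = contradiction (+-≤-+⇒≤ near-x (end-min x′ x′∈P)) (<⇒≱ d-far)

  end-minimal-bound : EndMinimal G d P → d x y + e x ≤ e y + (2 * k + 1)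
  end-minimal-bound end-min = subst (λ t → d x y + e x ≤ e y + t) (sym (2*k+1≡k+[1+k] k)) bound
    where
    bound : d x y + e x ≤ e y + (k + suc k)
    bound with d x y ≤? k
    ... | yes dxy≤k = ≤-trans (+-mono-≤ dxy≤k (end-min y (start-∈W P)))
                              (≤-trans (≤-reflexive (+-comm k (e y))) (+-monoʳ-≤ (e y) (m≤m+n k (suc k))))
    ... | no dxy≰k with vertex-at-distance (≰⇒> dxy≰k)
    ...   | x′ , x′∈P , dxx′≡1+k = begin
      d x y + e x            ≤⟨ +-monoʳ-≤ (d x y) (end-min x′ x′∈P) ⟩
      d x y + e x′           ≤⟨ bound-through x′∈P (far-vertex-near-y x′∈P (inj₂ (end-min , k<dxx′))) ⟩
      e y + (k + d x x′)     ≡⟨ cong (λ t → e y + (k + t)) dxx′≡1+k ⟩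
      e y + (k + suc k)      ∎
      where
      open ≤-Reasoning
      k<dxx′ : k < d x x′
      k<dxx′ = ≤-reflexive (sym dxx′≡1+k)

  strict-end-minimal-bound : StrictEndMinimal G d P → d x y + e x ≤ e y + (2 * k ∸ 1)
  strict-end-minimal-bound strict-min =
    subst (λ t → d x y + e x ≤ e y + t) (sym (2*k∸1≡k+[k∸1] k)) bound
    where
    c : ℕ
    c = k ∸ 1

    ex≤ey : e x ≤ e y
    ex≤ey with y ≟ᶠ x
    ... | yes refl = ≤-refl
    ... | no y≢x   = <⇒≤ (strict-min y (start-∈W P) y≢x)

    bound : d x y + e x ≤ e y + (k + c)
    bound with d x y ≤? c
    ... | yes dxy≤c = ≤-trans (+-mono-≤ dxy≤c ex≤ey)
                              (≤-trans (≤-reflexive (+-comm c (e y))) (+-monoʳ-≤ (e y) (m≤n+m c k)))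
    ... | no dxy≰c with vertex-at-distance (≰⇒> dxy≰c)
    ...   | x′ , x′∈P , dxx′≡1+c with strict-min x′ x′∈P (d≡1+n⇒≢ dxx′≡1+c) | near-x-or-near-y x′∈P
    ...     | ex<ex′ | inj₁ near-x = contradiction (m≤n+m∸n k 1)
                                       (<⇒≱ (+-≤-+⇒< (subst (λ t → t + e x′ ≤ e x + k) dxx′≡1+c near-x) ex<ex′))
    ...     | ex<ex′ | inj₂ near-y = a+[1+b]≤c+[k+[1+j]]⇒a+b≤c+[k+j] (d x y) (e x) (e y) k c (begin
      d x y + suc (e x)    ≤⟨ +-monoʳ-≤ (d x y) ex<ex′ ⟩
      d x y + e x′         ≤⟨ bound-through x′∈P near-y ⟩
      e y + (k + d x x′)   ≡⟨ cong (λ t → e y + (k + t)) dxx′≡1+c ⟩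
      e y + (k + suc c)    ∎)
      where open ≤-Reasoning

lemma19 : (G : Graph) (d : V G → V G → ℕ) → IsDistance G d → Connected G →
          (k : ℕ) → Hyperbolic2δ G d k →
          (y x : V G) {m : ℕ} (P : Walk G y x m) → IsShortest G d P →
          (StrictEndMinimal G d P → d x y + ecc G d x ≤ ecc G d y + (2 * k ∸ 1))
          × (EndMinimal G d P → d x y + ecc G d x ≤ ecc G d y + (2 * k + 1))
          × ((x′ : V G) → _∈W_ G x′ P →
               (2 * ecc G d x + k < 2 * ecc G d x′ ⊎ (EndMinimal G d P × k < d x x′)) →
               d y x′ + ecc G d x′ ≤ ecc G d y + k)
lemma19 G d isD _ k hyp y x P short =
  strict-end-minimal-bound , end-minimal-bound , λ x′ → far-vertex-near-y {x′}
  where open ShortestPath G d isD k hyp P short
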